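{- If $\ell > 3$ is an odd integer, then no Steiner triple system of order $3\ell-2$ has an $\ell$-good sequencing.
   Context: A Steiner triple system of order $v$ (an STS$(v)$) is a pair $(X,\mathcal{B})$ where $X$ is a set of $v$ points and $\mathcal{B}$ is a set of 3-subsets of $X$ (blocks) such that every pair of distinct points lies in exactly one block. For an integer $\ell \geq 3$, an $\ell$-good sequencing of $(X,\mathcal{B})$ is a permutation $[x_1\, x_2\, \cdots\, x_v]$ of $X$ such that no $\ell$ consecutive points $x_j, x_{j+1},\dots,x_{j+\ell-1}$ of the permutation contain a block of $\mathcal{B}$. -}

module Defs where

open import Data.Nat using (ℕ; _+_; _≤_; _<_)
open import Data.Fin using (Fin; toℕ)
open import Data.Fin.Subset using (Subset; _∈_; ∣_∣)
open import Data.Fin.Permutation using (Permutation′; _⟨$⟩ʳ_; _⟨$⟩ˡ_)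
open import Data.List using (List)
import Data.List.Membership.Propositional as L
open import Data.List.Relation.Unary.Unique.Propositional using (Unique)
open import Data.Product using (Σ; _×_; ∃)
open import Relation.Binary.PropositionalEquality using (_≡_)
open import Relation.Nullary using (¬_)

-- A Steiner triple system on the point set Fin v (any v-element set is
-- in bijection with Fin v).  Blocks are 3-element subsets of Fin v,
-- given as a duplicate-free list.
record STS (v : ℕ) : Set where
  field
    blocks      : List (Subset v)
    blocksDistinct : Unique blocks
    blockSize   : ∀ {B} → B L.∈ blocks → ∣ B ∣ ≡ 3
    covered     : ∀ (x y : Fin v) → ¬ (x ≡ y) →
                  Σ (Subset v) λ B → B L.∈ blocks × x ∈ B × y ∈ B
    unique      : ∀ (x y : Fin v) → ¬ (x ≡ y) → ∀ {B C} →
                  B L.∈ blocks → C L.∈ blocks →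
                  x ∈ B → y ∈ B → x ∈ C → y ∈ C → B ≡ C

open STS public

-- A sequencing is a permutation π; position i holds the point π ⟨$⟩ʳ i.
InWindow : ∀ {v} → Permutation′ v → ℕ → ℕ → Subset v → Set
InWindow π ℓ j B = ∀ x → x ∈ B → j ≤ toℕ (π ⟨$⟩ˡ x) × toℕ (π ⟨$⟩ˡ x) < j + ℓ

Good : ∀ {v} → STS v → ℕ → Permutation′ v → Set
Good {v} S ℓ π = ∀ (j : ℕ) → j + ℓ ≤ v → ∀ {B} → B L.∈ blocks S → ¬ InWindow π ℓ j B

module Submission where

-- Split the positions 0 … 3ℓ−3 of a sequencing into a first half 0 … ℓ and a
-- second half, and weigh each ordered pair of positions: −1 if the two
-- positions lie in different halves; otherwise 0 on the diagonal, 2 if they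
-- are less than ℓ apart and −4 if they are at least ℓ apart.  In an ℓ-good
-- sequencing the three points of a block never fit in a window of length ℓ,
-- so some two of them are at least ℓ apart, and the three ordered pairs
-- (x, y), (y, z), (z, x) of a block {x, y, z} have total weight ≤ 0.  Summing
-- this over all ordered pairs (x, y), with z the third point of the block
-- through x and y, counts every ordered pair exactly three times, so three
-- times the total weight is ≤ 0.  A direct count gives total weight 6ℓ − 18,
-- which is positive for ℓ > 3.

open import Defs

module ThreeElementSubsets where

  open import Data.Nat using (suc; _+_)
  open import Data.Nat.Properties using (suc-injective)
  open import Data.Fin using (zero; suc; _≟_)
  open import Data.Fin.Subset using (Subset; _∈_; _-_; ∣_∣; ⁅_⁆; inside; outside; Nonempty)
  open import Data.Fin.Subset.Properties
    using (nonempty?; Empty-unique; ∣⊥∣≡0; p─⊥≡p; x∈p∧x≢y⇒x∈p-y; p─q⊆p)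
  open import Data.Vec.Base using (_∷_; here; there)
  open import Data.Product using (∃; _×_; _,_)
  open import Data.Sum using (_⊎_; inj₁; inj₂)
  open import Function using (_∘_)
  open import Relation.Nullary using (yes; no; contradiction)
  open import Relation.Binary.PropositionalEquality

  ∣p∣≡1+∣p-x∣ : ∀ {n} {p : Subset n} {x} → x ∈ p → ∣ p ∣ ≡ suc ∣ p - x ∣
  ∣p∣≡1+∣p-x∣ {p = inside ∷ p} here = cong suc (cong ∣_∣ (sym (p─⊥≡p p)))
  ∣p∣≡1+∣p-x∣ {p = inside ∷ p} (there x∈p) = cong suc (∣p∣≡1+∣p-x∣ x∈p)
  ∣p∣≡1+∣p-x∣ {p = outside ∷ p} (there x∈p) = ∣p∣≡1+∣p-x∣ x∈p

  ∣p∣≡2+∣p-x-y∣ : ∀ {n} {p : Subset n} {x y} → x ∈ p → y ∈ p → x ≢ y → ∣ p ∣ ≡ 2 + ∣ p - x - y ∣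
  ∣p∣≡2+∣p-x-y∣ x∈p y∈p x≢y =
    trans (∣p∣≡1+∣p-x∣ x∈p) (cong suc (∣p∣≡1+∣p-x∣ (x∈p∧x≢y⇒x∈p-y y∈p (x≢y ∘ sym))))

  x∈p-y⇒x≢y : ∀ {n} {p : Subset n} {x y} → x ∈ p - y → x ≢ y
  x∈p-y⇒x≢y {p = _ ∷ _} {zero} {zero} ()
  x∈p-y⇒x≢y {p = _ ∷ _} {zero} {suc y} _ ()
  x∈p-y⇒x≢y {p = _ ∷ _} {suc x} {zero} _ ()
  x∈p-y⇒x≢y {p = _ ∷ _} {suc x} {suc y} (there x∈p-y) refl = x∈p-y⇒x≢y x∈p-y refl

  ∣p∣≡1+k⇒Nonempty : ∀ {n} {p : Subset n} {k} → ∣ p ∣ ≡ suc k → Nonempty p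
  ∣p∣≡1+k⇒Nonempty {n} {p} ∣p∣≡1+k with nonempty? p
  ... | yes p≢∅ = p≢∅
  ... | no p≡∅ =
    contradiction (trans (sym ∣p∣≡1+k) (trans (cong ∣_∣ (Empty-unique p≡∅)) (∣⊥∣≡0 n))) λ ()

  module _ {n} {B : Subset n} (∣B∣≡3 : ∣ B ∣ ≡ 3) {x y} (x∈B : x ∈ B) (y∈B : y ∈ B) (x≢y : x ≢ y) where

    ∣B-x-y∣≡1 : ∣ B - x - y ∣ ≡ 1
    ∣B-x-y∣≡1 = suc-injective (suc-injective (trans (sym (∣p∣≡2+∣p-x-y∣ x∈B y∈B x≢y)) ∣B∣≡3))

    third-element : ∃ λ z → z ∈ B × z ≢ x × z ≢ y
    third-element with ∣p∣≡1+k⇒Nonempty ∣B-x-y∣≡1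
    ... | z , z∈B-x-y = z , z∈B , x∈p-y⇒x≢y z∈B-x , x∈p-y⇒x≢y z∈B-x-y
      where
      z∈B-x : z ∈ B - x
      z∈B-x = p─q⊆p (B - x) ⁅ y ⁆ z∈B-x-y
      z∈B : z ∈ B
      z∈B = p─q⊆p B ⁅ x ⁆ z∈B-x

    ∈-3-subset : ∀ {z} → z ∈ B → z ≢ x → z ≢ y → ∀ {a} → a ∈ B → a ≡ x ⊎ a ≡ y ⊎ a ≡ z
    ∈-3-subset {z} z∈B z≢x z≢y {a} a∈B with a ≟ x | a ≟ y | a ≟ z
    ... | yes a≡x | _ | _ = inj₁ a≡x
    ... | no _ | yes a≡y | _ = inj₂ (inj₁ a≡y)
    ... | no _ | no _ | yes a≡z = inj₂ (inj₂ a≡z)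
    ... | no a≢x | no a≢y | no a≢z = contradiction
        (trans (sym ∣B-x-y∣≡1) (∣p∣≡2+∣p-x-y∣ (∈B-x-y z∈B z≢x z≢y) (∈B-x-y a∈B a≢x a≢y) (a≢z ∘ sym)))
        λ ()
      where
      ∈B-x-y : ∀ {c} → c ∈ B → c ≢ x → c ≢ y → c ∈ B - x - y
      ∈B-x-y c∈B c≢x c≢y = x∈p∧x≢y⇒x∈p-y (x∈p∧x≢y⇒x∈p-y c∈B c≢x) c≢y

module ThirdPoint {v} (S : STS v) where

  open import Data.Fin using (Fin; _≟_)
  open import Data.Fin.Subset using (_∈_)
  import Data.List.Membership.Propositional as List
  open import Data.Product using (∃; _×_; _,_; proj₁; proj₂)
  open import Data.Sum using (inj₁; inj₂)
  open import Function using (_∘_)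
  open import Relation.Nullary using (Dec; yes; no; contradiction)
  open import Relation.Binary.PropositionalEquality
  open ThreeElementSubsets using (third-element; ∈-3-subset)

  BlockThrough : Fin v → Fin v → Fin v → Set
  BlockThrough x y z = ∃ λ B → B List.∈ blocks S × x ∈ B × y ∈ B × z ∈ B

  private
    third-of : ∀ {x y} → x ≢ y → ∃ λ z → z ≢ x × z ≢ y × BlockThrough x y z
    third-of {x} {y} x≢y with covered S x y x≢y
    ... | B , B∈S , x∈B , y∈B with third-element (blockSize S B∈S) x∈B y∈B x≢y
    ... | z , z∈B , z≢x , z≢y = z , z≢x , z≢y , B , B∈S , x∈B , y∈B , z∈B

  -- Setting third x x = x makes each λ x → third x y an involution of all of Fin v.
  third : Fin v → Fin v → Fin v
  third x y with x ≟ y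
  ... | yes _ = x
  ... | no x≢y = proj₁ (third-of x≢y)

  third-spec : ∀ {x y} → x ≢ y → third x y ≢ x × third x y ≢ y × BlockThrough x y (third x y)
  third-spec {x} {y} x≢y with x ≟ y
  ... | yes x≡y = contradiction x≡y x≢y
  ... | no x≢y = proj₂ (third-of x≢y)

  third-diag : ∀ x → third x x ≡ x
  third-diag x with x ≟ x
  ... | yes _ = refl
  ... | no x≢x = contradiction refl x≢x

  third-unique : ∀ {x y z} → x ≢ y → z ≢ x → z ≢ y → BlockThrough x y z → third x y ≡ z
  third-unique {x} {y} {z} x≢y z≢x z≢y (B , B∈S , x∈B , y∈B , z∈B)
    with third-spec x≢y
  ... | t≢x , t≢y , C , C∈S , x∈C , y∈C , t∈C
    with ∈-3-subset (blockSize S B∈S) x∈B y∈B x≢y z∈B z≢x z≢y t∈B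
    where
    t∈B : third x y ∈ B
    t∈B = subst (third x y ∈_) (unique S x y x≢y C∈S B∈S x∈C y∈C x∈B y∈B) t∈C
  ... | inj₁ t≡x = contradiction t≡x t≢x
  ... | inj₂ (inj₁ t≡y) = contradiction t≡y t≢y
  ... | inj₂ (inj₂ t≡z) = t≡z

  third-involutiveˡ : ∀ x y → third (third x y) y ≡ x
  third-involutiveˡ x y = by-cases (x ≟ y)
    where
    by-cases : Dec (x ≡ y) → third (third x y) y ≡ x
    by-cases (yes refl) = trans (cong (λ z → third z x) (third-diag x)) (third-diag x)
    by-cases (no x≢y) with third-spec x≢y
    ... | t≢x , t≢y , B , B∈S , x∈B , y∈B , t∈B =
      third-unique t≢y (t≢x ∘ sym) x≢y (B , B∈S , t∈B , y∈B , x∈B)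

  third-involutiveʳ : ∀ x y → third x (third x y) ≡ y
  third-involutiveʳ x y = by-cases (x ≟ y)
    where
    by-cases : Dec (x ≡ y) → third x (third x y) ≡ y
    by-cases (yes refl) = trans (cong (third x) (third-diag x)) (third-diag x)
    by-cases (no x≢y) with third-spec x≢y
    ... | t≢x , t≢y , B , B∈S , x∈B , y∈B , t∈B =
      third-unique (t≢x ∘ sym) (x≢y ∘ sym) (t≢y ∘ sym) (B , B∈S , x∈B , t∈B , y∈B)

module Sums where

  open import Data.Nat as ℕ using (ℕ; zero; suc; _<_)
  open import Data.Integer as ℤ using (ℤ; +_; _+_; _*_; _≤_)
  import Data.Integer.Properties as ℤ
  open import Data.Fin using (Fin; zero; suc; toℕ)
  open import Data.Fin.Properties using (toℕ<n)
  open import Data.Fin.Permutation using (Permutation′; permutation; _⟨$⟩ʳ_)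
  open import Function using (_∘_; const)
  open import Relation.Binary.PropositionalEquality
  open import Algebra.Properties.CommutativeMonoid.Sum ℤ.+-0-commutativeMonoid public
    using (sum; ∑-distrib-+)
  open import Algebra.Properties.CommutativeMonoid.Sum ℤ.+-0-commutativeMonoid
    using (∑-comm; ∑-permute; sum-cong-≗)

  sum² : ∀ {n} → (Fin n → Fin n → ℤ) → ℤ
  sum² f = sum λ x → sum (f x)

  sum-nonpos : ∀ {n} (f : Fin n → ℤ) → (∀ i → f i ≤ + 0) → sum f ≤ + 0
  sum-nonpos {zero} f f≤0 = ℤ.≤-refl
  sum-nonpos {suc n} f f≤0 = ℤ.+-mono-≤ (f≤0 zero) (sum-nonpos (f ∘ suc) (f≤0 ∘ suc))

  sum²-nonpos : ∀ {n} (f : Fin n → Fin n → ℤ) → (∀ x y → f x y ≤ + 0) → sum² f ≤ + 0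
  sum²-nonpos f f≤0 = sum-nonpos _ λ x → sum-nonpos (f x) (f≤0 x)

  sum²-permute : ∀ {n} (f : Fin n → Fin n → ℤ) (σ : Permutation′ n) →
                 sum² (λ x y → f (σ ⟨$⟩ʳ x) (σ ⟨$⟩ʳ y)) ≡ sum² f
  sum²-permute f σ = trans (sum-cong-≗ λ x → sym (∑-permute (f (σ ⟨$⟩ʳ x)) σ))
                           (sym (∑-permute (λ x → sum (f x)) σ))

  ∑-distrib-+₃ : ∀ {n} (f g h : Fin n → ℤ) → sum (λ i → f i + g i + h i) ≡ sum f + sum g + sum h
  ∑-distrib-+₃ f g h = trans (∑-distrib-+ (λ i → f i + g i) h) (cong (_+ sum h) (∑-distrib-+ f g))

  involution : ∀ {n} (g : Fin n → Fin n) → (∀ x → g (g x) ≡ x) → Permutation′ n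
  involution g g∘g≗id = permutation g g g∘g≗id g∘g≗id

  module _ {n} (t : Fin n → Fin n → Fin n)
           (t-involutiveˡ : ∀ x y → t (t x y) y ≡ x) (t-involutiveʳ : ∀ x y → t x (t x y) ≡ y) where

    sum²-triangle : ∀ f → sum² (λ x y → f x y + f y (t x y) + f (t x y) x) ≡ sum² f + sum² f + sum² f
    sum²-triangle f = begin
      sum² (λ x y → f x y + f y (t x y) + f (t x y) x)
        ≡⟨ sum-cong-≗ (λ x → ∑-distrib-+₃ (f x) (λ y → f y (t x y)) (λ y → f (t x y) x)) ⟩
      sum (λ x → sum (f x) + sum (λ y → f y (t x y)) + sum (λ y → f (t x y) x))
        ≡⟨ ∑-distrib-+₃ (λ x → sum (f x)) (λ x → sum λ y → f y (t x y)) (λ x → sum λ y → f (t x y) x) ⟩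
      sum² f + sum² (λ x y → f y (t x y)) + sum² (λ x y → f (t x y) x)
        ≡⟨ cong₂ (λ a b → sum² f + a + b) second third ⟩
      sum² f + sum² f + sum² f ∎
      where
      open ≡-Reasoning
      second : sum² (λ x y → f y (t x y)) ≡ sum² f
      second = trans (∑-comm (λ x y → f y (t x y)))
        (sum-cong-≗ λ y → sym (∑-permute (f y) (involution (λ x → t x y) (λ x → t-involutiveˡ x y))))
      third : sum² (λ x y → f (t x y) x) ≡ sum² f
      third = trans (sum-cong-≗ λ x → sym (∑-permute (λ y → f y x) (involution (t x) (t-involutiveʳ x))))
                    (∑-comm (λ x y → f y x))

  sumTo : ℕ → (ℕ → ℤ) → ℤ
  sumTo n f = sum {n} (f ∘ toℕ)

  sumTo² : ℕ → (ℕ → ℕ → ℤ) → ℤ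
  sumTo² n f = sumTo n λ i → sumTo n (f i)

  sumTo-cong : ∀ n {f g : ℕ → ℤ} → (∀ {i} → i < n → f i ≡ g i) → sumTo n f ≡ sumTo n g
  sumTo-cong n f≗g = sum-cong-≗ (λ i → f≗g (toℕ<n i))

  sumTo-const : ∀ n c → sumTo n (const c) ≡ + n * c
  sumTo-const zero c = sym (ℤ.*-zeroˡ c)
  sumTo-const (suc n) c = trans (cong (_+_ c) (sumTo-const n c)) (sym (ℤ.suc-* (+ n) c))

  sumTo-+ : ∀ m n f → sumTo (m ℕ.+ n) f ≡ sumTo m f + sumTo n (f ∘ (m ℕ.+_))
  sumTo-+ zero n f = sym (ℤ.+-identityˡ _)
  sumTo-+ (suc m) n f = trans (cong (_+_ (f 0)) (sumTo-+ m n (f ∘ suc))) (sym (ℤ.+-assoc (f 0) _ _))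

  sumTo²-+ : ∀ m n f → sumTo² (m ℕ.+ n) f ≡
             (sumTo² m f + sumTo m (λ i → sumTo n (f i ∘ (m ℕ.+_))))
             + (sumTo n (λ k → sumTo m (f (m ℕ.+ k))) + sumTo² n (λ k → f (m ℕ.+ k) ∘ (m ℕ.+_)))
  sumTo²-+ m n f = begin
    sumTo² (m ℕ.+ n) f
      ≡⟨ sumTo-+ m n (λ i → sumTo (m ℕ.+ n) (f i)) ⟩
    sumTo m (λ i → sumTo (m ℕ.+ n) (f i)) + sumTo n (λ k → sumTo (m ℕ.+ n) (f (m ℕ.+ k)))
      ≡⟨ cong₂ _+_ (sumTo-cong m λ {i} _ → sumTo-+ m n (f i))
                   (sumTo-cong n λ {k} _ → sumTo-+ m n (f (m ℕ.+ k))) ⟩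
    sumTo m (λ i → sumTo m (f i) + sumTo n (f i ∘ (m ℕ.+_)))
      + sumTo n (λ k → sumTo m (f (m ℕ.+ k)) + sumTo n (f (m ℕ.+ k) ∘ (m ℕ.+_)))
      ≡⟨ cong₂ _+_ (∑-distrib-+ {m} _ _) (∑-distrib-+ {n} _ _) ⟩
    (sumTo² m f + sumTo m (λ i → sumTo n (f i ∘ (m ℕ.+_))))
      + (sumTo n (λ k → sumTo m (f (m ℕ.+ k))) + sumTo² n (λ k → f (m ℕ.+ k) ∘ (m ℕ.+_))) ∎
    where open ≡-Reasoning

module Windows where

  open import Data.Nat using (_+_; _∸_; _≤_; _<_; _⊓_; ∣_-_∣; z≤n)
  open import Data.Nat.Properties
  open import Data.Sum using (_⊎_; inj₁; inj₂)
  open import Data.Product using (∃; _×_; _,_)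
  open import Relation.Nullary using (yes; no)
  open import Relation.Binary.PropositionalEquality

  window-start : ∀ {ℓ v} m → ℓ ≤ v →
    ∃ λ j → j + ℓ ≤ v × (∀ {a} → m ≤ a → a < m + ℓ → a < v → j ≤ a × a < j + ℓ)
  window-start {ℓ} {v} m ℓ≤v with m ≤? v ∸ ℓ
  ... | yes m≤v∸ℓ =
    m , ≤-trans (+-monoˡ-≤ ℓ m≤v∸ℓ) (≤-reflexive (m∸n+n≡m ℓ≤v)) , λ m≤a a<m+ℓ _ → m≤a , a<m+ℓ
  ... | no m≰v∸ℓ =
    v ∸ ℓ , ≤-reflexive (m∸n+n≡m ℓ≤v) , λ m≤a _ a<v →
    ≤-trans (<⇒≤ (≰⇒> m≰v∸ℓ)) m≤a , <-≤-trans a<v (≤-reflexive (sym (m∸n+n≡m ℓ≤v)))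

  ∣m-n∣<ℓ⇒m<n+ℓ : ∀ {m n ℓ} → ∣ m - n ∣ < ℓ → m < n + ℓ
  ∣m-n∣<ℓ⇒m<n+ℓ {m} {n} d<ℓ = ≤-<-trans (m≤n+∣m-n∣ m n) (+-monoʳ-< n d<ℓ)

  near-triple-in-window : ∀ {ℓ v p q r} → ℓ ≤ v → p < v → q < v → r < v →
    ∣ p - q ∣ < ℓ → ∣ q - r ∣ < ℓ → ∣ r - p ∣ < ℓ →
    ∃ λ j → j + ℓ ≤ v × (∀ {a} → a ≡ p ⊎ a ≡ q ⊎ a ≡ r → j ≤ a × a < j + ℓ)
  near-triple-in-window {ℓ} {v} {p} {q} {r} ℓ≤v p<v q<v r<v pq qr rp
    with window-start (p ⊓ q ⊓ r) ℓ≤v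
  ... | j , j+ℓ≤v , covers = j , j+ℓ≤v , λ a∈pqr → covers (min≤ a∈pqr) (<min+ℓ a∈pqr) (<v a∈pqr)
    where
    self : ∀ a → a < a + ℓ
    self a = ∣m-n∣<ℓ⇒m<n+ℓ (subst (_< ℓ) (sym (∣n-n∣≡0 a)) (≤-<-trans z≤n pq))
    near-sym : ∀ a b → ∣ a - b ∣ < ℓ → ∣ b - a ∣ < ℓ
    near-sym a b = subst (_< ℓ) (∣-∣-comm a b)
    <v : ∀ {a} → a ≡ p ⊎ a ≡ q ⊎ a ≡ r → a < v
    <v (inj₁ refl) = p<v
    <v (inj₂ (inj₁ refl)) = q<v
    <v (inj₂ (inj₂ refl)) = r<v
    min≤ : ∀ {a} → a ≡ p ⊎ a ≡ q ⊎ a ≡ r → p ⊓ q ⊓ r ≤ a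
    min≤ (inj₁ refl) = ≤-trans (m⊓n≤m (p ⊓ q) r) (m⊓n≤m p q)
    min≤ (inj₂ (inj₁ refl)) = ≤-trans (m⊓n≤m (p ⊓ q) r) (m⊓n≤n p q)
    min≤ (inj₂ (inj₂ refl)) = m⊓n≤n (p ⊓ q) r
    <each+ℓ : ∀ {a} → a ≡ p ⊎ a ≡ q ⊎ a ≡ r → a < p + ℓ × a < q + ℓ × a < r + ℓ
    <each+ℓ (inj₁ refl) = self p , ∣m-n∣<ℓ⇒m<n+ℓ pq , ∣m-n∣<ℓ⇒m<n+ℓ (near-sym r p rp)
    <each+ℓ (inj₂ (inj₁ refl)) = ∣m-n∣<ℓ⇒m<n+ℓ (near-sym p q pq) , self q , ∣m-n∣<ℓ⇒m<n+ℓ qr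
    <each+ℓ (inj₂ (inj₂ refl)) = ∣m-n∣<ℓ⇒m<n+ℓ rp , ∣m-n∣<ℓ⇒m<n+ℓ (near-sym q r qr) , self r
    <min+ℓ : ∀ {a} → a ≡ p ⊎ a ≡ q ⊎ a ≡ r → a < p ⊓ q ⊓ r + ℓ
    <min+ℓ a∈pqr with <each+ℓ a∈pqr
    ... | <p+ℓ , <q+ℓ , <r+ℓ =
      subst (_ <_) (sym (trans (+-distribʳ-⊓ ℓ (p ⊓ q) r) (cong (_⊓ (r + ℓ)) (+-distribʳ-⊓ ℓ p q))))
        (⊓-glb (⊓-glb <p+ℓ <q+ℓ) <r+ℓ)

module Weights where

  open import Data.Nat as ℕ using (ℕ; zero; suc; _∸_; _≤_; _<_; z≤n; s≤s; _≤?_; ∣_-_∣)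
  import Data.Nat.Properties as ℕ
  import Data.Nat.Tactic.RingSolver as ℕ-Solver
  open import Data.Integer as ℤ using (ℤ; +_; -[1+_]; _+_; _*_; _-_)
  import Data.Integer.Properties as ℤ
  open import Data.Integer.Tactic.RingSolver using (solve-∀)
  open import Data.Bool using (Bool; true; false; if_then_else_; _xor_)
  open import Data.Bool.Properties using (xor-same)
  open import Function using (_∘_)
  open import Relation.Nullary using (¬_; does; yes; no)
  open import Relation.Nullary.Decidable using (dec-true; dec-false)
  open import Relation.Binary.PropositionalEquality
  open Sums

  nearFarWeight : ℕ → ℕ → ℤ
  nearFarWeight ℓ d = if does (ℓ ≤? d) then -[1+ 3 ] else + 2

  distanceWeight : ℕ → ℕ → ℤ
  distanceWeight ℓ zero = + 0
  distanceWeight ℓ d@(suc _) = nearFarWeight ℓ d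

  sideWeight : Bool → Bool → ℤ → ℤ
  sideWeight s t w = if s xor t then -[1+ 0 ] else w

  weight : ℕ → ℕ → ℕ → ℤ
  weight ℓ i j = sideWeight (does (i ≤? ℓ)) (does (j ≤? ℓ)) (distanceWeight ℓ ∣ i - j ∣)

  cyclicWeight : ℕ → ℕ → ℕ → ℕ → ℤ
  cyclicWeight ℓ p q r = weight ℓ p q + weight ℓ q r + weight ℓ r p

  data HasFarPair (ℓ p q r : ℕ) : Set where
    far-pq : ℓ ≤ ∣ p - q ∣ → HasFarPair ℓ p q r
    far-qr : ℓ ≤ ∣ q - r ∣ → HasFarPair ℓ p q r
    far-rp : ℓ ≤ ∣ r - p ∣ → HasFarPair ℓ p q r

  distanceWeight≤2 : ∀ ℓ d → distanceWeight ℓ d ℤ.≤ + 2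
  distanceWeight≤2 ℓ zero = ℤ.+≤+ z≤n
  distanceWeight≤2 ℓ (suc d) with does (ℓ ≤? suc d)
  ... | true = ℤ.-≤+
  ... | false = ℤ.≤-refl

  distanceWeight-far : ∀ {ℓ d} → 0 < ℓ → ℓ ≤ d → distanceWeight ℓ d ≡ -[1+ 3 ]
  distanceWeight-far {suc _} {zero} _ ()
  distanceWeight-far {ℓ} {suc d} _ ℓ≤d rewrite dec-true (ℓ ≤? suc d) ℓ≤d = refl

  +₃-mono-≤ : ∀ a b c {a′ b′ c′} → a ℤ.≤ a′ → b ℤ.≤ b′ → c ℤ.≤ c′ → a + b + c ℤ.≤ a′ + b′ + c′
  +₃-mono-≤ a b c a≤a′ b≤b′ c≤c′ = ℤ.+-mono-≤ (ℤ.+-mono-≤ a≤a′ b≤b′) c≤c′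

  -- Unless all three points lie in one half, two of the three pairs cross between the halves.
  sideWeights≤0 : ∀ s t u {a b c} → a ≡ -[1+ 3 ] → b ℤ.≤ + 2 → c ℤ.≤ + 2 →
                  sideWeight s t a + sideWeight t u b + sideWeight u s c ℤ.≤ + 0
  sideWeights≤0 true  true  true  {a} {b} {c} refl b≤2 c≤2 = +₃-mono-≤ a b c ℤ.≤-refl b≤2 c≤2
  sideWeights≤0 false false false {a} {b} {c} refl b≤2 c≤2 = +₃-mono-≤ a b c ℤ.≤-refl b≤2 c≤2
  sideWeights≤0 true  true  false {a} refl _ _ =
    +₃-mono-≤ a -[1+ 0 ] -[1+ 0 ] ℤ.≤-refl (ℤ.-≤+ {n = 2}) (ℤ.-≤+ {n = 2})
  sideWeights≤0 false false true  {a} refl _ _ =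
    +₃-mono-≤ a -[1+ 0 ] -[1+ 0 ] ℤ.≤-refl (ℤ.-≤+ {n = 2}) (ℤ.-≤+ {n = 2})
  sideWeights≤0 true  false true  {c = c} _ _ c≤2 = +₃-mono-≤ -[1+ 0 ] -[1+ 0 ] c ℤ.≤-refl ℤ.≤-refl c≤2
  sideWeights≤0 false true  false {c = c} _ _ c≤2 = +₃-mono-≤ -[1+ 0 ] -[1+ 0 ] c ℤ.≤-refl ℤ.≤-refl c≤2
  sideWeights≤0 true  false false {b = b} _ b≤2 _ = +₃-mono-≤ -[1+ 0 ] b -[1+ 0 ] ℤ.≤-refl b≤2 ℤ.≤-refl
  sideWeights≤0 false true  true  {b = b} _ b≤2 _ = +₃-mono-≤ -[1+ 0 ] b -[1+ 0 ] ℤ.≤-refl b≤2 ℤ.≤-refl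

  cyclicWeight≤0-far : ∀ {ℓ} p q r → 0 < ℓ → ℓ ≤ ∣ p - q ∣ → cyclicWeight ℓ p q r ℤ.≤ + 0
  cyclicWeight≤0-far {ℓ} p q r 0<ℓ far =
    sideWeights≤0 (does (p ≤? ℓ)) (does (q ≤? ℓ)) (does (r ≤? ℓ))
      (distanceWeight-far 0<ℓ far) (distanceWeight≤2 ℓ ∣ q - r ∣) (distanceWeight≤2 ℓ ∣ r - p ∣)

  cyclicWeight-rotate : ∀ ℓ p q r → cyclicWeight ℓ p q r ≡ cyclicWeight ℓ q r p
  cyclicWeight-rotate ℓ p q r = rotate (weight ℓ p q) (weight ℓ q r) (weight ℓ r p)
    where
    rotate : ∀ a b c → a + b + c ≡ b + c + a
    rotate = solve-∀

  cyclicWeight≤0 : ∀ {ℓ p q r} → 0 < ℓ → HasFarPair ℓ p q r → cyclicWeight ℓ p q r ℤ.≤ + 0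
  cyclicWeight≤0 {p = p} {q} {r} 0<ℓ (far-pq far) = cyclicWeight≤0-far p q r 0<ℓ far
  cyclicWeight≤0 {ℓ} {p} {q} {r} 0<ℓ (far-qr far) =
    subst (ℤ._≤ + 0) (sym (cyclicWeight-rotate ℓ p q r)) (cyclicWeight≤0-far q r p 0<ℓ far)
  cyclicWeight≤0 {ℓ} {p} {q} {r} 0<ℓ (far-rp far) =
    subst (ℤ._≤ + 0) (sym (trans (cyclicWeight-rotate ℓ p q r) (cyclicWeight-rotate ℓ q r p)))
      (cyclicWeight≤0-far r p q 0<ℓ far)

  cyclicWeight-diag : ∀ ℓ p → cyclicWeight ℓ p p p ≡ + 0
  cyclicWeight-diag ℓ p rewrite xor-same (does (p ≤? ℓ)) | ℕ.∣n-n∣≡0 p = refl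

  nearFarWeight-suc : ∀ k d → nearFarWeight (suc k) (suc d) ≡ nearFarWeight k d
  nearFarWeight-suc zero d = refl
  nearFarWeight-suc (suc k) d = refl

  sumTo-nearFarWeight : ∀ k n → sumTo n (nearFarWeight k) ≡ + 2 * + n - + 6 * + (n ∸ k)
  sumTo-nearFarWeight zero n = trans (sumTo-const n -[1+ 3 ]) (all-far (+ n))
    where
    all-far : ∀ n → n * -[1+ 3 ] ≡ + 2 * n - + 6 * n
    all-far = solve-∀
  sumTo-nearFarWeight (suc k) zero = refl
  sumTo-nearFarWeight (suc k) (suc n) = begin
    + 2 + sumTo n (nearFarWeight (suc k) ∘ suc)
      ≡⟨ cong (_+_ (+ 2)) (sumTo-cong n λ {d} _ → nearFarWeight-suc k d) ⟩
    + 2 + sumTo n (nearFarWeight k)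
      ≡⟨ cong (_+_ (+ 2)) (sumTo-nearFarWeight k n) ⟩
    + 2 + (+ 2 * + n - + 6 * + (n ∸ k))
      ≡⟨ one-more-near (+ n) (+ (n ∸ k)) ⟩
    + 2 * + suc n - + 6 * + (n ∸ k) ∎
    where
    open ≡-Reasoning
    one-more-near : ∀ n c → + 2 + (+ 2 * n - + 6 * c) ≡ + 2 * (+ 1 + n) - + 6 * c
    one-more-near = solve-∀

  -- For ℓ = k + 1 and c = n ∸ k, exactly c (c − 1) ordered pairs of 0 … n − 1 are at least ℓ apart.
  intervalWeight : ℤ → ℤ → ℤ
  intervalWeight n c = + 2 * n * (n - + 1) - + 6 * c * (c - + 1)

  intervalWeight-suc : ∀ k n → let r = + 2 * + n - + 6 * + (n ∸ k) in
    (+ 0 + r) + (r + intervalWeight (+ n) (+ (n ∸ k))) ≡ intervalWeight (+ suc n) (+ (suc n ∸ k))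
  intervalWeight-suc k n with k ℕ.≤? n
  ... | yes k≤n rewrite ℕ.+-∸-assoc 1 k≤n = step (+ n) (+ (n ∸ k))
    where
    step : ∀ n c →
      (+ 0 + (+ 2 * n - + 6 * c)) + ((+ 2 * n - + 6 * c) + (+ 2 * n * (n - + 1) - + 6 * c * (c - + 1)))
      ≡ + 2 * (+ 1 + n) * ((+ 1 + n) - + 1) - + 6 * (+ 1 + c) * ((+ 1 + c) - + 1)
    step = solve-∀
  ... | no k≰n rewrite ℕ.m≤n⇒m∸n≡0 (ℕ.<⇒≤ (ℕ.≰⇒> k≰n)) | ℕ.m≤n⇒m∸n≡0 (ℕ.≰⇒> k≰n) = step (+ n)
    where
    step : ∀ n →
      (+ 0 + (+ 2 * n - + 6 * + 0))
        + ((+ 2 * n - + 6 * + 0) + (+ 2 * n * (n - + 1) - + 6 * + 0 * (+ 0 - + 1)))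
      ≡ + 2 * (+ 1 + n) * ((+ 1 + n) - + 1) - + 6 * + 0 * (+ 0 - + 1)
    step = solve-∀

  sumTo²-distanceWeight : ∀ k n →
    sumTo² n (λ i j → distanceWeight (suc k) ∣ i - j ∣) ≡ intervalWeight (+ n) (+ (n ∸ k))
  sumTo²-distanceWeight k zero = cong (intervalWeight (+ 0) ∘ +_) (sym (ℕ.0∸n≡0 k))
  sumTo²-distanceWeight k (suc n) = begin
    (+ 0 + r) + sumTo n (λ i → distanceWeight (suc k) (suc i) + sumTo n (g i))
      ≡⟨ cong (_+_ (+ 0 + r)) (∑-distrib-+ {n} _ _) ⟩
    (+ 0 + r) + (r + sumTo² n g)
      ≡⟨ cong₂ (λ r a → (+ 0 + r) + (r + a)) row (sumTo²-distanceWeight k n) ⟩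
    _ ≡⟨ intervalWeight-suc k n ⟩
    intervalWeight (+ suc n) (+ (suc n ∸ k)) ∎
    where
    open ≡-Reasoning
    g : ℕ → ℕ → ℤ
    g i j = distanceWeight (suc k) ∣ i - j ∣
    r : ℤ
    r = sumTo n (distanceWeight (suc k) ∘ suc)
    row : r ≡ + 2 * + n - + 6 * + (n ∸ k)
    row = trans (sumTo-cong n λ {d} _ → nearFarWeight-suc k d) (sumTo-nearFarWeight k n)

  module _ (ℓ : ℕ) where

    beyond-first-half : ∀ i → ¬ suc ℓ ℕ.+ i ≤ ℓ
    beyond-first-half i = ℕ.<⇒≱ (ℕ.m≤m+n (suc ℓ) i)

    weight-first-half : ∀ {i j} → i < suc ℓ → j < suc ℓ → weight ℓ i j ≡ distanceWeight ℓ ∣ i - j ∣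
    weight-first-half {i} {j} i<1+ℓ j<1+ℓ
      rewrite dec-true (i ≤? ℓ) (ℕ.≤-pred i<1+ℓ) | dec-true (j ≤? ℓ) (ℕ.≤-pred j<1+ℓ) = refl

    weight-second-half : ∀ i j → weight ℓ (suc ℓ ℕ.+ i) (suc ℓ ℕ.+ j) ≡ distanceWeight ℓ ∣ i - j ∣
    weight-second-half i j
      rewrite dec-false (suc ℓ ℕ.+ i ≤? ℓ) (beyond-first-half i)
            | dec-false (suc ℓ ℕ.+ j ≤? ℓ) (beyond-first-half j)
      = cong (distanceWeight ℓ) (ℕ.∣m+n-m+o∣≡∣n-o∣ (suc ℓ) i j)

    weight-acrossʳ : ∀ {i} j → i < suc ℓ → weight ℓ i (suc ℓ ℕ.+ j) ≡ -[1+ 0 ]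
    weight-acrossʳ {i} j i<1+ℓ
      rewrite dec-true (i ≤? ℓ) (ℕ.≤-pred i<1+ℓ) | dec-false (suc ℓ ℕ.+ j ≤? ℓ) (beyond-first-half j) = refl

    weight-acrossˡ : ∀ {i} j → i < suc ℓ → weight ℓ (suc ℓ ℕ.+ j) i ≡ -[1+ 0 ]
    weight-acrossˡ {i} j i<1+ℓ
      rewrite dec-true (i ≤? ℓ) (ℕ.≤-pred i<1+ℓ) | dec-false (suc ℓ ℕ.+ j ≤? ℓ) (beyond-first-half j) = refl

    first-half-block : sumTo² (suc ℓ) (weight ℓ) ≡ sumTo² (suc ℓ) (λ i j → distanceWeight ℓ ∣ i - j ∣)
    first-half-block =
      sumTo-cong (suc ℓ) λ i<1+ℓ → sumTo-cong (suc ℓ) λ j<1+ℓ → weight-first-half i<1+ℓ j<1+ℓ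

    second-half-block : ∀ m → sumTo² m (λ i → weight ℓ (suc ℓ ℕ.+ i) ∘ (suc ℓ ℕ.+_))
                        ≡ sumTo² m (λ i j → distanceWeight ℓ ∣ i - j ∣)
    second-half-block m = sumTo-cong m λ {i} _ → sumTo-cong m λ {j} _ → weight-second-half i j

    across-blockʳ : ∀ m → sumTo (suc ℓ) (λ i → sumTo m (weight ℓ i ∘ (suc ℓ ℕ.+_)))
                          ≡ + suc ℓ * (+ m * -[1+ 0 ])
    across-blockʳ m = trans
      (sumTo-cong (suc ℓ) λ i<1+ℓ →
        trans (sumTo-cong m λ {j} _ → weight-acrossʳ j i<1+ℓ) (sumTo-const m _))
      (sumTo-const (suc ℓ) _)

    across-blockˡ : ∀ m → sumTo m (λ j → sumTo (suc ℓ) (weight ℓ (suc ℓ ℕ.+ j)))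
                          ≡ + m * (+ suc ℓ * -[1+ 0 ])
    across-blockˡ m = trans
      (sumTo-cong m λ {j} _ →
        trans (sumTo-cong (suc ℓ) λ i<1+ℓ → weight-acrossˡ j i<1+ℓ) (sumTo-const (suc ℓ) _))
      (sumTo-const m _)

  3ℓ∸2≡halves : ∀ k → 3 ℕ.* (2 ℕ.+ k) ∸ 2 ≡ suc (2 ℕ.+ k) ℕ.+ (k ℕ.+ suc k)
  3ℓ∸2≡halves k = split k
    where
    split : ∀ k → k ℕ.+ (2 ℕ.+ k ℕ.+ (2 ℕ.+ k ℕ.+ 0)) ≡ 3 ℕ.+ k ℕ.+ (k ℕ.+ (1 ℕ.+ k))
    split = ℕ-Solver.solve-∀

  totalWeight : ∀ {ℓ} → 2 ≤ ℓ → sumTo² (3 ℕ.* ℓ ∸ 2) (weight ℓ) ≡ + 6 * (+ ℓ - + 3)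
  totalWeight {ℓ@(suc (suc k))} (s≤s (s≤s z≤n)) = begin
    sumTo² (3 ℕ.* ℓ ∸ 2) (weight ℓ)
      ≡⟨ cong (λ v → sumTo² v (weight ℓ)) (3ℓ∸2≡halves k) ⟩
    sumTo² (suc ℓ ℕ.+ m) (weight ℓ)
      ≡⟨ sumTo²-+ (suc ℓ) m (weight ℓ) ⟩
    (sumTo² (suc ℓ) (weight ℓ) + sumTo (suc ℓ) (λ i → sumTo m (weight ℓ i ∘ (suc ℓ ℕ.+_))))
      + (sumTo m (λ j → sumTo (suc ℓ) (weight ℓ (suc ℓ ℕ.+ j)))
         + sumTo² m (λ i → weight ℓ (suc ℓ ℕ.+ i) ∘ (suc ℓ ℕ.+_)))
      ≡⟨ cong₂ _+_ (cong₂ _+_ first (across-blockʳ ℓ m)) (cong₂ _+_ (across-blockˡ ℓ m) second) ⟩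
    (intervalWeight (+ suc ℓ) (+ 2) + + suc ℓ * (+ m * -[1+ 0 ]))
      + (+ m * (+ suc ℓ * -[1+ 0 ]) + intervalWeight (+ m) (+ k))
      ≡⟨ count (+ k) ⟩
    + 6 * (+ ℓ - + 3) ∎
    where
    open ≡-Reasoning
    m : ℕ
    m = k ℕ.+ suc k
    first : sumTo² (suc ℓ) (weight ℓ) ≡ intervalWeight (+ suc ℓ) (+ 2)
    first = trans (first-half-block ℓ) (trans (sumTo²-distanceWeight (suc k) (suc ℓ))
      (cong (intervalWeight (+ suc ℓ) ∘ +_) (ℕ.m+n∸n≡m 2 (suc k))))
    second : sumTo² m (λ i → weight ℓ (suc ℓ ℕ.+ i) ∘ (suc ℓ ℕ.+_)) ≡ intervalWeight (+ m) (+ k)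
    second = trans (second-half-block ℓ m) (trans (sumTo²-distanceWeight (suc k) m)
      (cong (intervalWeight (+ m) ∘ +_) (ℕ.m+n∸n≡m k (suc k))))
    count : ∀ k → let ℓ = + 2 + k ; m = k + (+ 1 + k) in
      (+ 2 * (+ 1 + ℓ) * ((+ 1 + ℓ) - + 1) - + 6 * + 2 * (+ 2 - + 1) + (+ 1 + ℓ) * (m * -[1+ 0 ]))
      + (m * ((+ 1 + ℓ) * -[1+ 0 ]) + (+ 2 * m * (m - + 1) - + 6 * k * (k - + 1)))
      ≡ + 6 * (ℓ - + 3)
    count = solve-∀

open import Data.Nat using (ℕ; _<_; _*_; _+_; _∸_; _≤_; suc; s≤s; z≤n)
open import Data.Fin.Permutation using (Permutation′)
open import Data.Product using (Σ; ∃; _,_)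
open import Relation.Binary.PropositionalEquality using (_≡_; subst; sym)
open import Relation.Nullary using (¬_; contradiction)
import Data.Nat.Properties as ℕ
import Data.Integer as ℤ
import Data.Integer.Properties as ℤ
open Weights using (3ℓ∸2≡halves; totalWeight)

module GoodSequencing {v} (S : STS v) {ℓ} (π : Permutation′ v) (good : Good S ℓ π)
                      (0<ℓ : 0 < ℓ) (ℓ≤v : ℓ ≤ v) where

  open import Data.Nat using (_≤?_; ∣_-_∣)
  open import Data.Nat.Properties using (≰⇒>)
  open import Data.Integer using (+_)
  open import Data.Fin using (Fin; toℕ; _≟_)
  open import Data.Fin.Properties using (toℕ<n)
  open import Data.Fin.Permutation using (_⟨$⟩ˡ_; flip)
  import Data.Sum as Sum
  open import Relation.Nullary using (Dec; yes; no)
  open import Relation.Binary.PropositionalEquality using (_≢_; refl; cong; trans)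
  open ThreeElementSubsets using (∈-3-subset)
  open ThirdPoint S
  open Sums using (sum²; sumTo²; sum²-nonpos; sum²-triangle; sum²-permute)
  open Windows using (near-triple-in-window)
  open Weights

  position : Fin v → ℕ
  position x = toℕ (π ⟨$⟩ˡ x)

  block-has-far-pair : ∀ {x y} → x ≢ y → HasFarPair ℓ (position x) (position y) (position (third x y))
  block-has-far-pair {x} {y} x≢y
    with ℓ ≤? ∣ position x - position y ∣
       | ℓ ≤? ∣ position y - position (third x y) ∣
       | ℓ ≤? ∣ position (third x y) - position x ∣
  ... | yes far | _ | _ = far-pq far
  ... | no _ | yes far | _ = far-qr far
  ... | no _ | no _ | yes far = far-rp far
  ... | no near₁ | no near₂ | no near₃ with third-spec x≢y
  ... | t≢x , t≢y , B , B∈S , x∈B , y∈B , t∈B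
    with near-triple-in-window ℓ≤v (toℕ<n _) (toℕ<n _) (toℕ<n _) (≰⇒> near₁) (≰⇒> near₂) (≰⇒> near₃)
  ... | j , j+ℓ≤v , covers = contradiction in-window (good j j+ℓ≤v B∈S)
    where
    in-window : InWindow π ℓ j B
    in-window a a∈B =
      covers (Sum.map (cong position) (Sum.map (cong position) (cong position))
                (∈-3-subset (blockSize S B∈S) x∈B y∈B x≢y t∈B t≢x t≢y a∈B))

  block-weight≤0 : ∀ x y → cyclicWeight ℓ (position x) (position y) (position (third x y)) ℤ.≤ + 0
  block-weight≤0 x y = by-cases (x ≟ y)
    where
    by-cases : Dec (x ≡ y) → cyclicWeight ℓ (position x) (position y) (position (third x y)) ℤ.≤ + 0
    by-cases (yes refl) rewrite third-diag x = ℤ.≤-reflexive (cyclicWeight-diag ℓ (position x))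
    by-cases (no x≢y) = cyclicWeight≤0 0<ℓ (block-has-far-pair x≢y)

  thrice-totalWeight≤0 : let T = sumTo² v (weight ℓ) in T ℤ.+ T ℤ.+ T ℤ.≤ + 0
  thrice-totalWeight≤0 = subst (ℤ._≤ + 0) three-copies (sum²-nonpos _ block-weight≤0)
    where
    w : Fin v → Fin v → ℤ.ℤ
    w x y = weight ℓ (position x) (position y)
    sum²-w : sum² w ≡ sumTo² v (weight ℓ)
    sum²-w = sum²-permute (λ i j → weight ℓ (toℕ i) (toℕ j)) (flip π)
    three-copies : sum² (λ x y → cyclicWeight ℓ (position x) (position y) (position (third x y)))
                   ≡ sumTo² v (weight ℓ) ℤ.+ sumTo² v (weight ℓ) ℤ.+ sumTo² v (weight ℓ)
    three-copies = trans (sum²-triangle third third-involutiveˡ third-involutiveʳ w)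
                         (cong (λ T → T ℤ.+ T ℤ.+ T) sum²-w)

theorem2p2 : ∀ (ℓ : ℕ) → 3 < ℓ → (∃ λ k → ℓ ≡ 2 * k + 1) → (S : STS (3 * ℓ ∸ 2)) →
             ¬ (Σ (Permutation′ (3 * ℓ ∸ 2)) λ π → Good S ℓ π)
theorem2p2 ℓ@(suc (suc k@(suc (suc _)))) (s≤s (s≤s (s≤s (s≤s z≤n)))) _ S (π , good) =
  contradiction thrice-T≤0 λ { (ℤ.+≤+ ()) }
  where
  ℓ≤v : ℓ ≤ 3 * ℓ ∸ 2
  ℓ≤v = subst (ℓ ≤_) (sym (3ℓ∸2≡halves k)) (ℕ.≤-trans (ℕ.n≤1+n ℓ) (ℕ.m≤m+n (suc ℓ) _))
  thrice-T≤0 : let T = ℤ.+ 6 ℤ.* (ℤ.+ ℓ ℤ.- ℤ.+ 3) in T ℤ.+ T ℤ.+ T ℤ.≤ ℤ.+ 0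
  thrice-T≤0 = subst (λ T → T ℤ.+ T ℤ.+ T ℤ.≤ ℤ.+ 0) (totalWeight {ℓ} (s≤s (s≤s z≤n)))
                 (GoodSequencing.thrice-totalWeight≤0 S π good (s≤s z≤n) ℓ≤v)
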